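{- Let $P$ be a finite poset. The map $I\mapsto(\mathrm{Max}(I),\mathrm{Floor}(I))$ is a bijection from the set of interval-closed sets of $P$ to the set of pairs $(A,B)$ of disjoint antichains of $P$ such that every element of $B$ lies in the order ideal $\Delta(A)$ generated by $A$.
   Context: A subset $I\subseteq P$ is interval-closed if whenever $x,y\in I$ and $x\le z\le y$, then $z\in I$. For $S\subseteq P$, $\Delta(S)$ denotes the smallest order ideal of $P$ containing $S$. $\mathrm{Max}(I)$ is the set of maximal elements of $I$, and $\mathrm{Floor}(I)$ is the set of maximal elements of $\Delta(I)-I$. -}

module Defs where

open import Level using (0ℓ)
open import Data.Nat using (ℕ)
open import Data.Fin using (Fin)
open import Data.Fin.Properties using (any?; all?)
open import Data.Fin.Subset using (Subset; _∈_; _─_; _⊆_)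
open import Data.Fin.Subset.Properties using (_∈?_)
open import Data.Product using (Σ; ∃; _×_; _,_)
open import Data.Empty using (⊥)
open import Data.Vec using (tabulate)
open import Relation.Nullary using (¬_; does)
open import Relation.Nullary.Decidable using (_×-dec_; ¬?)
open import Relation.Binary using (Rel; Decidable)
open import Relation.Binary.PropositionalEquality using (_≡_)
open import Data.Fin.Properties using (_≟_)

-- A finite poset is represented on the carrier Fin n by a relation _≤_
-- (assumed to be a decidable partial order in the statement).

module _ {n : ℕ} {_≤_ : Rel (Fin n) 0ℓ} (_≤?_ : Decidable _≤_) where

  Δ : Subset n → Subset n
  Δ S = tabulate (λ x → does (any? (λ y → (y ∈? S) ×-dec (x ≤? y))))

  Max : Subset n → Subset n
  Max I = tabulate (λ x → does ((x ∈? I) ×-dec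
            ¬? (any? (λ y → (y ∈? I) ×-dec ((x ≤? y) ×-dec ¬? (y ≟ x))))))

  Floor : Subset n → Subset n
  Floor I = Max (Δ I ─ I)

module _ {n : ℕ} (_≤_ : Rel (Fin n) 0ℓ) where

  IntervalClosed : Subset n → Set
  IntervalClosed I = ∀ x y z → x ∈ I → y ∈ I → x ≤ z → z ≤ y → z ∈ I

  Antichain : Subset n → Set
  Antichain A = ∀ x y → x ∈ A → y ∈ A → x ≤ y → x ≡ y

Disjoint : {n : ℕ} → Subset n → Subset n → Set
Disjoint A B = ∀ x → x ∈ A → x ∈ B → ⊥

-- For interval-closed I, every
-- element of Δ I − I lies below a maximal one, i.e. below Floor I, and
-- interval-closedness forbids an element of I from lying below Floor I;
-- hence I = Δ(Max I) − Δ(Floor I), which gives injectivity. Conversely,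
-- for a pair (A , B) as in the statement, I = Δ A − Δ B is interval-closed,
-- and both Max I = A and Floor I = B follow from one observation: an
-- antichain A with A ⊆ S ⊆ Δ A is exactly the set of maximal elements of S.
module Submission where

open import Defs
open import Level using (Level; 0ℓ)
open import Data.Nat using (ℕ)
open import Data.Fin using (Fin)
open import Data.Fin.Subset using (Subset; _⊆_; _∈_; _∉_; _─_; inside)
open import Data.Product using (Σ; ∃; _×_; _,_; proj₁; proj₂)
open import Relation.Binary using (Rel; IsDecPartialOrder)
open import Relation.Binary.PropositionalEquality using (_≡_)

open import Data.Fin.Subset.Properties using (_∈?_; ⊆-antisym; x∈p∧x∉q⇒x∈p─q; p─q⊆p)
open import Data.Fin.Properties using (any?; _≟_)
open import Data.Fin.Induction using (po-noetherian)
open import Data.Vec using (_∷_; tabulate; here; there)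
open import Data.Vec.Properties using (lookup∘tabulate; []=⇒lookup; lookup⇒[]=)
open import Function using (_∘_)
open import Induction.WellFounded using (Acc; acc)
open import Relation.Nullary using (Dec; yes; no; ¬_; does; contradiction)
open import Relation.Nullary.Decidable using (_×-dec_; ¬?; dec-true; decidable-stable)
open import Relation.Unary using (Pred; Decidable)
open import Relation.Binary.PropositionalEquality using (sym; trans; subst; cong₂; module ≡-Reasoning)

module _ {n : ℕ} {ℓ : Level} {P : Pred (Fin n) ℓ} (P? : Decidable P) where

  ∈-tabulate-does⁺ : ∀ {x} → P x → x ∈ tabulate (does ∘ P?)
  ∈-tabulate-does⁺ {x} px = lookup⇒[]= x _ (trans (lookup∘tabulate _ x) (dec-true (P? x) px))

  ∈-tabulate-does⁻ : ∀ {x} → x ∈ tabulate (does ∘ P?) → P x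
  ∈-tabulate-does⁻ {x} x∈ with P? x | trans (sym (lookup∘tabulate (does ∘ P?) x)) ([]=⇒lookup x∈)
  ... | yes px | _ = px
  ... | no _   | ()

x∈p─q⇒x∉q : ∀ {n} (p q : Subset n) {x} → x ∈ p ─ q → x ∉ q
x∈p─q⇒x∉q (_ ∷ p) (_      ∷ q) (there x∈p─q) (there x∈q) = x∈p─q⇒x∉q p q x∈p─q x∈q
x∈p─q⇒x∉q (_ ∷ p) (inside ∷ q) ()            here

module _ {n : ℕ} {_≤_ : Rel (Fin n) 0ℓ} (po : IsDecPartialOrder _≡_ _≤_) where

  open IsDecPartialOrder po using (_≤?_; isPartialOrder; antisym)
    renaming (refl to ≤-refl; trans to ≤-trans)

  private
    Δ′ Max′ Floor′ : Subset n → Subset n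
    Δ′     = Δ _≤?_
    Max′   = Max _≤?_
    Floor′ = Floor _≤?_

  ∈Δ⁺ : ∀ {S x y} → y ∈ S → x ≤ y → x ∈ Δ′ S
  ∈Δ⁺ {S} y∈S x≤y = ∈-tabulate-does⁺ (λ x → any? λ y → (y ∈? S) ×-dec (x ≤? y)) (_ , y∈S , x≤y)

  ∈Δ⁻ : ∀ {S x} → x ∈ Δ′ S → ∃ λ y → y ∈ S × x ≤ y
  ∈Δ⁻ {S} = ∈-tabulate-does⁻ (λ x → any? λ y → (y ∈? S) ×-dec (x ≤? y))

  ⊆Δ : ∀ {S} → S ⊆ Δ′ S
  ⊆Δ x∈S = ∈Δ⁺ x∈S ≤-refl

  Δ-downward : ∀ {S x y} → x ≤ y → y ∈ Δ′ S → x ∈ Δ′ S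
  Δ-downward x≤y y∈ΔS with ∈Δ⁻ y∈ΔS
  ... | s , s∈S , y≤s = ∈Δ⁺ s∈S (≤-trans x≤y y≤s)

  Δ-least : ∀ {S T} → S ⊆ Δ′ T → Δ′ S ⊆ Δ′ T
  Δ-least S⊆ΔT x∈ΔS with ∈Δ⁻ x∈ΔS
  ... | s , s∈S , x≤s = Δ-downward x≤s (S⊆ΔT s∈S)

  Δ-mono : ∀ {S T} → S ⊆ T → Δ′ S ⊆ Δ′ T
  Δ-mono S⊆T = Δ-least (⊆Δ ∘ S⊆T)

  private
    Above? : (S : Subset n) (x y : Fin n) → Dec (y ∈ S × x ≤ y × ¬ y ≡ x)
    Above? S x y = (y ∈? S) ×-dec ((x ≤? y) ×-dec ¬? (y ≟ x))

  ∈Max⁺ : ∀ {S x} → x ∈ S → (∀ {y} → y ∈ S → x ≤ y → y ≡ x) → x ∈ Max′ S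
  ∈Max⁺ {S} x∈S maximal = ∈-tabulate-does⁺ (λ x → (x ∈? S) ×-dec ¬? (any? (Above? S x)))
    (x∈S , λ (_ , y∈S , x≤y , y≢x) → y≢x (maximal y∈S x≤y))

  ∈Max⁻ : ∀ {S x} → x ∈ Max′ S → x ∈ S × (∀ {y} → y ∈ S → x ≤ y → y ≡ x)
  ∈Max⁻ {S} x∈Max with ∈-tabulate-does⁻ (λ x → (x ∈? S) ×-dec ¬? (any? (Above? S x))) x∈Max
  ... | x∈S , nothing-above =
    x∈S , λ {y} y∈S x≤y → decidable-stable (y ≟ _) (λ y≢x → nothing-above (y , y∈S , x≤y , y≢x))

  Max⊆ : ∀ {S} → Max′ S ⊆ S
  Max⊆ = proj₁ ∘ ∈Max⁻

  Max-antichain : ∀ S → Antichain _≤_ (Max′ S)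
  Max-antichain S x y x∈Max y∈Max x≤y = sym (proj₂ (∈Max⁻ x∈Max) (Max⊆ y∈Max) x≤y)

  ⊆Δ-Max : ∀ {S} → S ⊆ Δ′ (Max′ S)
  ⊆Δ-Max {S} {x} x∈S = go x (po-noetherian isPartialOrder x) x∈S
    where
    go : ∀ x → Acc (λ y x → x ≤ y × ¬ x ≡ y) x → x ∈ S → x ∈ Δ′ (Max′ S)
    go x (acc rec) x∈S with any? (Above? S x)
    ... | yes (y , y∈S , x≤y , y≢x) = Δ-downward x≤y (go y (rec (x≤y , y≢x ∘ sym)) y∈S)
    ... | no nothing-above = ⊆Δ (∈Max⁺ x∈S λ {y} y∈S x≤y →
          decidable-stable (y ≟ x) (λ y≢x → nothing-above (y , y∈S , x≤y , y≢x)))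

  Floor⊆Δ-Max : ∀ I → Floor′ I ⊆ Δ′ (Max′ I)
  Floor⊆Δ-Max I = Δ-least ⊆Δ-Max ∘ p─q⊆p (Δ′ I) I ∘ Max⊆

  Max-Floor-disjoint : ∀ I → Disjoint (Max′ I) (Floor′ I)
  Max-Floor-disjoint I x x∈Max x∈Floor = x∈p─q⇒x∉q (Δ′ I) I (Max⊆ x∈Floor) (Max⊆ x∈Max)

  antichain-squeeze : ∀ {A a y} → Antichain _≤_ A → a ∈ A → a ≤ y → y ∈ Δ′ A → y ≡ a
  antichain-squeeze antichain a∈A a≤y y∈ΔA with ∈Δ⁻ y∈ΔA
  ... | a′ , a′∈A , y≤a′ = antisym (subst (_ ≤_) (sym a≡a′) y≤a′) a≤y
    where a≡a′ = antichain _ a′ a∈A a′∈A (≤-trans a≤y y≤a′)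

  Max-antichain-sandwich : ∀ {A S} → Antichain _≤_ A → A ⊆ S → S ⊆ Δ′ A → Max′ S ≡ A
  Max-antichain-sandwich {A} {S} antichain A⊆S S⊆ΔA = ⊆-antisym Max⊆A A⊆Max
    where
    Max⊆A : Max′ S ⊆ A
    Max⊆A x∈Max with ∈Max⁻ x∈Max
    ... | x∈S , maximal with ∈Δ⁻ (S⊆ΔA x∈S)
    ...   | a , a∈A , x≤a = subst (_∈ A) (maximal (A⊆S a∈A) x≤a) a∈A
    A⊆Max : A ⊆ Max′ S
    A⊆Max a∈A = ∈Max⁺ (A⊆S a∈A) λ y∈S a≤y → antichain-squeeze antichain a∈A a≤y (S⊆ΔA y∈S)

  intervalClosed-decomposition : ∀ {I} → IntervalClosed _≤_ I → I ≡ Δ′ (Max′ I) ─ Δ′ (Floor′ I)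
  intervalClosed-decomposition {I} closed = ⊆-antisym I⊆difference difference⊆I
    where
    I⊆difference : I ⊆ Δ′ (Max′ I) ─ Δ′ (Floor′ I)
    I⊆difference {x} x∈I = x∈p∧x∉q⇒x∈p─q (⊆Δ-Max x∈I) λ x∈ΔFloor →
      let f , f∈Floor , x≤f = ∈Δ⁻ x∈ΔFloor
          f∈ΔI─I = Max⊆ f∈Floor
          y , y∈I , f≤y = ∈Δ⁻ (p─q⊆p (Δ′ I) I f∈ΔI─I)
      in x∈p─q⇒x∉q (Δ′ I) I f∈ΔI─I (closed x y f x∈I y∈I x≤f f≤y)
    -- Were x ∉ I, it would lie in Δ I − I and hence below Floor I = Max (Δ I − I).
    difference⊆I : Δ′ (Max′ I) ─ Δ′ (Floor′ I) ⊆ I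
    difference⊆I {x} x∈difference with x ∈? I
    ... | yes x∈I = x∈I
    ... | no x∉I = contradiction
          (⊆Δ-Max (x∈p∧x∉q⇒x∈p─q (Δ-mono Max⊆ (p─q⊆p _ _ x∈difference)) x∉I))
          (x∈p─q⇒x∉q _ _ x∈difference)

  Max-Floor-injective : ∀ {I J} → IntervalClosed _≤_ I → IntervalClosed _≤_ J →
                        Max′ I ≡ Max′ J → Floor′ I ≡ Floor′ J → I ≡ J
  Max-Floor-injective {I} {J} closedI closedJ Max≡ Floor≡ = begin
    I                            ≡⟨ intervalClosed-decomposition closedI ⟩
    Δ′ (Max′ I) ─ Δ′ (Floor′ I)  ≡⟨ cong₂ (λ A B → Δ′ A ─ Δ′ B) Max≡ Floor≡ ⟩
    Δ′ (Max′ J) ─ Δ′ (Floor′ J)  ≡⟨ intervalClosed-decomposition closedJ ⟨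
    J                            ∎
    where open ≡-Reasoning

  Δ─Δ-intervalClosed : ∀ S T → IntervalClosed _≤_ (Δ′ S ─ Δ′ T)
  Δ─Δ-intervalClosed S T x y z x∈ y∈ x≤z z≤y =
    x∈p∧x∉q⇒x∈p─q (Δ-downward z≤y (p─q⊆p _ _ y∈))
                  (λ z∈ΔT → x∈p─q⇒x∉q _ _ x∈ (Δ-downward x≤z z∈ΔT))

  module _ {A B : Subset n} (antichainA : Antichain _≤_ A) (antichainB : Antichain _≤_ B)
           (disjoint : Disjoint A B) (B⊆ΔA : B ⊆ Δ′ A) where

    A⊆Δ─Δ : A ⊆ Δ′ A ─ Δ′ B
    A⊆Δ─Δ {a} a∈A = x∈p∧x∉q⇒x∈p─q (⊆Δ a∈A) λ a∈ΔB →
      let b , b∈B , a≤b = ∈Δ⁻ a∈ΔB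
          b≡a = antichain-squeeze antichainA a∈A a≤b (B⊆ΔA b∈B)
      in disjoint a a∈A (subst (_∈ B) b≡a b∈B)

    Max-Δ─Δ : Max′ (Δ′ A ─ Δ′ B) ≡ A
    Max-Δ─Δ = Max-antichain-sandwich antichainA A⊆Δ─Δ (p─q⊆p _ _)

    Floor-Δ─Δ : Floor′ (Δ′ A ─ Δ′ B) ≡ B
    Floor-Δ─Δ = Max-antichain-sandwich antichainB B⊆ΔI─I ΔI─I⊆ΔB
      where
      I : Subset n
      I = Δ′ A ─ Δ′ B
      B⊆ΔI─I : B ⊆ Δ′ I ─ I
      B⊆ΔI─I b∈B = x∈p∧x∉q⇒x∈p─q (Δ-mono A⊆Δ─Δ (B⊆ΔA b∈B))
                                 (λ b∈I → x∈p─q⇒x∉q _ _ b∈I (⊆Δ b∈B))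
      ΔI─I⊆ΔB : Δ′ I ─ I ⊆ Δ′ B
      ΔI─I⊆ΔB {x} x∈ΔI─I with x ∈? Δ′ B
      ... | yes x∈ΔB = x∈ΔB
      ... | no x∉ΔB = contradiction
            (x∈p∧x∉q⇒x∈p─q (Δ-least (p─q⊆p _ _) (p─q⊆p _ _ x∈ΔI─I)) x∉ΔB)
            (x∈p─q⇒x∉q _ _ x∈ΔI─I)

proposition2p5 : (n : ℕ) (_≤_ : Rel (Fin n) 0ℓ) (po : IsDecPartialOrder _≡_ _≤_) →
    let _≤?_ = IsDecPartialOrder._≤?_ po in
    ((I : Subset n) → IntervalClosed _≤_ I →
        Antichain _≤_ (Max _≤?_ I) × Antichain _≤_ (Floor _≤?_ I)
        × Disjoint (Max _≤?_ I) (Floor _≤?_ I) × Floor _≤?_ I ⊆ Δ _≤?_ (Max _≤?_ I))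
    × ((I J : Subset n) → IntervalClosed _≤_ I → IntervalClosed _≤_ J →
        Max _≤?_ I ≡ Max _≤?_ J → Floor _≤?_ I ≡ Floor _≤?_ J → I ≡ J)
    × ((A B : Subset n) → Antichain _≤_ A → Antichain _≤_ B → Disjoint A B → B ⊆ Δ _≤?_ A →
        Σ (Subset n) (λ I → IntervalClosed _≤_ I × Max _≤?_ I ≡ A × Floor _≤?_ I ≡ B))
proposition2p5 n _≤_ po =
  (λ I _ → Max-antichain po I , Max-antichain po (Δ _≤?_ I ─ I) ,
           Max-Floor-disjoint po I , Floor⊆Δ-Max po I) ,
  (λ I J → Max-Floor-injective po) ,
  λ A B antichainA antichainB disjoint B⊆ΔA →
    Δ _≤?_ A ─ Δ _≤?_ B , Δ─Δ-intervalClosed po A B ,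
    Max-Δ─Δ po antichainA antichainB disjoint B⊆ΔA ,
    Floor-Δ─Δ po antichainA antichainB disjoint B⊆ΔA
  where open IsDecPartialOrder po using (_≤?_)
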